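{- Let $\mathcal M$ be a map and let $e\neq f$ be edges of $\mathcal M$. If $\mathcal M\setminus e/ f$ is defined (i.e. $e$ is not a bridge of $\mathcal M$ and $f$ is not a separating loop of $\mathcal M\setminus e$), then $\mathcal M/ f\setminus e$ is also defined (i.e. $f$ is not a separating loop of $\mathcal M$ and $e$ is not a bridge of $\mathcal M/f$), and $\mathcal M\setminus e/ f=\mathcal M/ f\setminus e$.
   Context: A map is a triple $\mathcal M=(B,\sigma,\alpha)$ with $B$ a finite set (of flags), $\sigma,\alpha\in\mathrm{Sym}(B)$, $\alpha$ a fixed-point-free involution, and $\langle\sigma,\alpha\rangle$ transitive on $B$; permutations compose as functions. Edges are cycles of $\alpha$, vertices cycles of $\sigma$, faces cycles of $\sigma\alpha$. $G(\mathcal M)$ is the graph with vertices the cycles of $\sigma$ and edges the cycles of $\alpha$, edge $e$ incident to vertex $v$ iff $e\cap v\ne\emptyset$. The dual map is $\mathcal M^\ast=(B,\sigma\alpha,\alpha)$. A bridge of $\mathcal M$ is an edge $e$ with $G(\mathcal M)-e$ disconnected; a separating loop is an edge $e$ with $G(\mathcal M^\ast)-e$ disconnected. For $\mu\in\mathrm{Sym}(B)$ and $B'\subseteq B$, $\mu_{|B'}\in\mathrm{Sym}(B')$ is $\mu_{|B'}(b)=\mu^k(b)$ with $k\ge1$ least such that $\mu^k(b)\in B'$. For an edge $e$ that is not a bridge, the deletion is $\mathcal M\setminus e=(B\setminus e,\sigma_{|B\setminus e},\alpha_{|B\setminus e})$; for an edge $e$ that is not a separating loop, the contraction is $\mathcal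 M/e=(B\setminus e,(\sigma\alpha)_{|B\setminus e}\,\alpha_{|B\setminus e},\alpha_{|B\setminus e})$. (These are maps.) -}

module Defs where

open import Data.Nat using (ℕ; zero; suc)
open import Data.Fin using (Fin; _≟_)
open import Data.Bool using (Bool; true; false; if_then_else_; _∧_; _∨_; not)
open import Data.Product using (_×_)
open import Relation.Nullary using (¬_)
open import Relation.Nullary.Decidable using (⌊_⌋)
open import Relation.Binary.PropositionalEquality using (_≡_)

-- Flags live in an ambient finite type Fin n; the flag set B of a map is a
-- decidable subset of Fin n.  Permutations are functions Fin n → Fin n of
-- which only the values on B are relevant.
record RawMap (n : ℕ) : Set where
  constructor rawMap
  field
    B : Fin n → Bool
    σ : Fin n → Fin n
    α : Fin n → Fin n
open RawMap public

_∈B_ : ∀ {n} → Fin n → RawMap n → Set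
b ∈B M = B M b ≡ true

_∘ₚ_ : ∀ {n} → (Fin n → Fin n) → (Fin n → Fin n) → Fin n → Fin n
(μ ∘ₚ ν) b = μ (ν b)

-- Reachability in the graph whose "vertex moves" are σ-steps and whose
-- "edge moves" are α-steps across flags not in the excluded set E
-- (symmetric, reflexive, transitive closure; steps only from flags in B).
data Conn {n : ℕ} (Bs : Fin n → Bool) (σ α : Fin n → Fin n) (E : Fin n → Bool)
     : Fin n → Fin n → Set where
  done  : ∀ {b} → Conn Bs σ α E b b
  σ-fwd : ∀ {b c} → Bs b ≡ true → Conn Bs σ α E (σ b) c → Conn Bs σ α E b c
  σ-bwd : ∀ {b c} → Bs b ≡ true → Conn Bs σ α E b c → Conn Bs σ α E (σ b) c
  α-fwd : ∀ {b c} → Bs b ≡ true → E b ≡ false → Conn Bs σ α E (α b) c → Conn Bs σ α E b c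
  α-bwd : ∀ {b c} → Bs b ≡ true → E b ≡ false → Conn Bs σ α E b c → Conn Bs σ α E (α b) c

record IsMap {n : ℕ} (M : RawMap n) : Set where
  field
    σ-closed : ∀ b → b ∈B M → σ M b ∈B M
    σ-inj    : ∀ b c → b ∈B M → c ∈B M → σ M b ≡ σ M c → b ≡ c
    α-closed : ∀ b → b ∈B M → α M b ∈B M
    α-invol  : ∀ b → b ∈B M → α M (α M b) ≡ b
    α-fpf    : ∀ b → b ∈B M → ¬ (α M b ≡ b)
    transitive : ∀ b c → b ∈B M → c ∈B M → Conn (B M) (σ M) (α M) (λ _ → false) b c

edgeOf : ∀ {n} → RawMap n → Fin n → Fin n → Bool
edgeOf M x b = ⌊ b ≟ x ⌋ ∨ ⌊ b ≟ α M x ⌋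

-- G(M) - e is connected, for e the edge containing x.  Vertices of G(M) are
-- the σ-cycles (represented by their flags); an edge {b, α b} ≠ e joins the
-- vertex containing b to the vertex containing α b.
ConnectedWithout : ∀ {n} → RawMap n → Fin n → Set
ConnectedWithout M x =
  ∀ b c → b ∈B M → c ∈B M → Conn (B M) (σ M) (α M) (edgeOf M x) b c

IsBridge : ∀ {n} → RawMap n → Fin n → Set
IsBridge M x = ¬ ConnectedWithout M x

dual : ∀ {n} → RawMap n → RawMap n
dual M = rawMap (B M) (σ M ∘ₚ α M) (α M)

IsSepLoop : ∀ {n} → RawMap n → Fin n → Set
IsSepLoop M x = IsBridge (dual M) x

-- μ_{|B'}(b) = μ^k(b) with k ≥ 1 least such that μ^k(b) ∈ B'.
-- Computed by searching μ^1(b), …, μ^n(b) (n = size of the ambient type,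
-- which bounds all cycle lengths, so the search always succeeds for
-- b ∈ B' ⊆ B and μ a permutation of B).
restrictAux : ∀ {n} → ℕ → (Fin n → Fin n) → (Fin n → Bool) → Fin n → Fin n → Fin n
restrictAux zero    μ P b c = b
restrictAux (suc k) μ P b c = if P (μ c) then μ c else restrictAux k μ P b (μ c)

restrict : ∀ {n} → (Fin n → Fin n) → (Fin n → Bool) → Fin n → Fin n
restrict {n} μ P b = restrictAux n μ P b b

removeEdge : ∀ {n} → RawMap n → Fin n → Fin n → Bool
removeEdge M x b = B M b ∧ not (edgeOf M x b)

delete : ∀ {n} → RawMap n → Fin n → RawMap n
delete M x = rawMap B' (restrict (σ M) B') (restrict (α M) B')
  where B' = removeEdge M x

contract : ∀ {n} → RawMap n → Fin n → RawMap n
contract M x =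
  rawMap B' (restrict (σ M ∘ₚ α M) B' ∘ₚ restrict (α M) B') (restrict (α M) B')
  where B' = removeEdge M x

MapEq : ∀ {n} → RawMap n → RawMap n → Set
MapEq M N = (∀ b → B M b ≡ B N b)
          × (∀ b → b ∈B M → (σ M b ≡ σ N b) × (α M b ≡ α N b))

-- Write φ = σα, and let e, f be the edges of x, y.  Both M ∖ e / f and M / f ∖ e have flag set
-- B ∖ (e ∪ f) with α unchanged, and both send a flag b to the first flag outside e ∪ f reached from
-- σ b by crossing flags of e with σ and flags of f with φ: deletion skips e along σ-orbits,
-- contraction (deletion in the dual) skips f along φ-orbits, in either order.
-- Connectivity of (M ∖ e)* − f lifts to M* − f, because in M* each flag of e is joined across e to a
-- flag of B ∖ e (e is not σ-invariant, M being connected).  Finally G(M / f) − e is connected: its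
-- part outside e is M / f ∖ e = M ∖ e / f, which is connected, and each flag z of e has σ_{M/f} z
-- outside e ∪ f or equal to α z.  The fixed point σ_{M/f} z = z is excluded case by case using that
-- neither e is a bridge of M nor f a separating loop of M ∖ e; if σ_{M/f} swaps the two flags of e,
-- then e is all of M / f.

module Submission where

open import Defs
open import Data.Nat using (ℕ; zero; suc; _+_; _≤_; _<_; z≤n; s≤s; _∸_)
open import Data.Nat.Properties
  using (≤-total; +-comm; +-suc; m+[n∸m]≡n; ≤-trans; <⇒≤; m<n⇒0<n∸m; m∸n≤m; ≤-pred; n<1+n)
open import Data.Fin using (Fin; _≟_; toℕ)
open import Data.Fin.Properties using (pigeonhole; toℕ<n)
open import Data.Bool using (Bool; true; false; if_then_else_; _∧_; _∨_; not)
open import Data.Product using (_×_; _,_; Σ; proj₁; proj₂)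
open import Data.Sum using (_⊎_; inj₁; inj₂)
open import Data.Empty using (⊥; ⊥-elim)
open import Relation.Nullary using (¬_; yes; no)
open import Relation.Nullary.Decidable using (⌊_⌋)
open import Relation.Binary.PropositionalEquality

private variable n : ℕ

contradictionᵇ : ∀ {a} {A : Set a} {b : Bool} → b ≡ true → b ≡ false → A
contradictionᵇ refl ()

-- Restriction of a permutation to a subset

iterate : (Fin n → Fin n) → ℕ → Fin n → Fin n
iterate μ zero    c = c
iterate μ (suc k) c = iterate μ k (μ c)

iterate-suc : ∀ (μ : Fin n → Fin n) k c → iterate μ (suc k) c ≡ μ (iterate μ k c)
iterate-suc μ zero    c = refl
iterate-suc μ (suc k) c = iterate-suc μ k (μ c)

iterate-+ : ∀ (μ : Fin n → Fin n) m d c → iterate μ (m + d) c ≡ iterate μ d (iterate μ m c)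
iterate-+ μ zero    d c = refl
iterate-+ μ (suc m) d c = iterate-+ μ m d (μ c)

record IsPermutationOn (D : Fin n → Bool) (μ : Fin n → Fin n) : Set where
  field
    closed    : ∀ b → D b ≡ true → D (μ b) ≡ true
    injective : ∀ b c → D b ≡ true → D c ≡ true → μ b ≡ μ c → b ≡ c
open IsPermutationOn public

record IsFpfInvolutionOn (D : Fin n → Bool) (α : Fin n → Fin n) : Set where
  field
    inv-closed    : ∀ b → D b ≡ true → D (α b) ≡ true
    involutive    : ∀ b → D b ≡ true → α (α b) ≡ b
    fixpoint-free : ∀ b → D b ≡ true → ¬ α b ≡ b
open IsFpfInvolutionOn public

module _ {D : Fin n → Bool} where

  involution⇒permutation : ∀ {α} → IsFpfInvolutionOn D α → IsPermutationOn D α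
  involution⇒permutation {α} iα = record
    { closed    = inv-closed iα
    ; injective = λ b c hb hc e →
        trans (sym (involutive iα b hb)) (trans (cong α e) (involutive iα c hc))
    }

  ∘-permutation : ∀ {μ ν} → IsPermutationOn D μ → IsPermutationOn D ν → IsPermutationOn D (μ ∘ₚ ν)
  ∘-permutation pμ pν = record
    { closed    = λ b hb → closed pμ _ (closed pν b hb)
    ; injective = λ b c hb hc e →
        injective pν b c hb hc (injective pμ _ _ (closed pν b hb) (closed pν c hc) e)
    }

  iterate-closed : ∀ {μ} → IsPermutationOn D μ → ∀ k c → D c ≡ true → D (iterate μ k c) ≡ true
  iterate-closed pμ zero    c h = h
  iterate-closed pμ (suc k) c h = iterate-closed pμ k _ (closed pμ c h)

  iterate-injective : ∀ {μ} → IsPermutationOn D μ → ∀ k a b → D a ≡ true → D b ≡ true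
                    → iterate μ k a ≡ iterate μ k b → a ≡ b
  iterate-injective pμ zero    a b ha hb e = e
  iterate-injective {μ} pμ (suc k) a b ha hb e =
    iterate-injective pμ k a b ha hb
      (injective pμ _ _ (iterate-closed pμ k a ha) (iterate-closed pμ k b hb)
        (trans (sym (iterate-suc μ k a)) (trans e (iterate-suc μ k b))))

  iterate-period : ∀ {μ} → IsPermutationOn D μ → ∀ a → D a ≡ true → ∀ {i j} → i < j
                 → iterate μ i a ≡ iterate μ j a → iterate μ (j ∸ i) a ≡ a
  iterate-period {μ} pμ a ha {i} {j} i<j μⁱa≡μʲa =
    sym (iterate-injective pμ i a _ ha (iterate-closed pμ (j ∸ i) a ha) shifted)
    where
    open ≡-Reasoning
    shifted : iterate μ i a ≡ iterate μ i (iterate μ (j ∸ i) a)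
    shifted = begin
      iterate μ i a                      ≡⟨ μⁱa≡μʲa ⟩
      iterate μ j a                      ≡⟨ cong (λ m → iterate μ m a) (sym (trans (+-comm (j ∸ i) i) (m+[n∸m]≡n (<⇒≤ i<j)))) ⟩
      iterate μ (j ∸ i + i) a            ≡⟨ iterate-+ μ (j ∸ i) i a ⟩
      iterate μ i (iterate μ (j ∸ i) a)  ∎

  iterate-returns : ∀ {μ} → IsPermutationOn D μ → ∀ a → D a ≡ true
                  → Σ ℕ λ d → 1 ≤ d × d ≤ n × iterate μ d a ≡ a
  iterate-returns {μ} pμ a ha with pigeonhole (n<1+n n) (λ i → iterate μ (toℕ i) a)
  ... | i , j , i<j , μⁱa≡μʲa =
    toℕ j ∸ toℕ i , m<n⇒0<n∸m i<j , ≤-trans (m∸n≤m (toℕ j) (toℕ i)) (≤-pred (toℕ<n j)) ,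
    iterate-period pμ a ha i<j μⁱa≡μʲa

data FirstHit (μ : Fin n → Fin n) (P : Fin n → Bool) : ℕ → Fin n → Fin n → Set where
  hit  : ∀ {c r}   → P (μ c) ≡ true  → μ c ≡ r → FirstHit μ P zero c r
  skip : ∀ {k c r} → P (μ c) ≡ false → FirstHit μ P k (μ c) r → FirstHit μ P (suc k) c r

data Prefix (μ : Fin n → Fin n) (P : Fin n → Bool) : Fin n → Fin n → Set where
  first : ∀ {d}   → Prefix μ P d (μ d)
  next  : ∀ {d u} → P (μ d) ≡ false → Prefix μ P (μ d) u → Prefix μ P d u

module _ {μ : Fin n → Fin n} {P : Fin n → Bool} where

  prefix-extend : ∀ {d u} → Prefix μ P d u → P u ≡ false → Prefix μ P d (μ u)
  prefix-extend first      h = next h first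
  prefix-extend (next h p) h' = next h (prefix-extend p h')

  prefix-firstHit : ∀ {d u} → Prefix μ P d u → P u ≡ true → Σ ℕ λ k → FirstHit μ P k d u
  prefix-firstHit first      h = zero , hit h refl
  prefix-firstHit (next h p) h' = let (k , q) = prefix-firstHit p h' in suc k , skip h q

  firstHit-unique : ∀ {k k' c r r'} → FirstHit μ P k c r → FirstHit μ P k' c r' → r ≡ r'
  firstHit-unique (hit _ e)  (hit _ e')  = trans (sym e) e'
  firstHit-unique (hit h _)  (skip h' _) = contradictionᵇ h h'
  firstHit-unique (skip h _) (hit h' _)  = contradictionᵇ h' h
  firstHit-unique (skip _ p) (skip _ q)  = firstHit-unique p q

  firstHit-∈ : ∀ {k c r} → FirstHit μ P k c r → P r ≡ true
  firstHit-∈ (hit h refl) = h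
  firstHit-∈ (skip _ p)   = firstHit-∈ p

  firstHit-iterate : ∀ {k c r} → FirstHit μ P k c r → r ≡ iterate μ (suc k) c
  firstHit-iterate (hit _ e)  = sym e
  firstHit-iterate (skip _ p) = firstHit-iterate p

  firstHit-avoids : ∀ {k c r} → FirstHit μ P k c r → ∀ i → 1 ≤ i → i ≤ k → P (iterate μ i c) ≡ false
  firstHit-avoids (skip h p) (suc zero)    _ _         = h
  firstHit-avoids (skip h p) (suc (suc i)) _ (s≤s i≤k) = firstHit-avoids p (suc i) (s≤s z≤n) i≤k

  firstHit-skip : ∀ {k s u r} → μ s ≡ u → P u ≡ false → FirstHit μ P k u r → FirstHit μ P (suc k) s r
  firstHit-skip refl h q = skip h q

  firstHit-fixpoint : ∀ {k c r} → μ c ≡ c → P c ≡ false → FirstHit μ P k c r → ⊥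
  firstHit-fixpoint μc≡c hc (hit h _)  = contradictionᵇ (trans (cong P (sym μc≡c)) h) hc
  firstHit-fixpoint μc≡c hc (skip _ p) = firstHit-fixpoint μc≡c hc (subst (λ t → FirstHit μ P _ t _) μc≡c p)

  restrictAux-firstHit : ∀ {k c r} → FirstHit μ P k c r → ∀ K b → k < K → restrictAux K μ P b c ≡ r
  restrictAux-firstHit (hit h e) (suc K) b _ rewrite h = e
  restrictAux-firstHit (skip h p) (suc K) b (s≤s k<K) rewrite h = restrictAux-firstHit p K b k<K

  firstHit-search : ∀ K c m → 1 ≤ m → m ≤ K → P (iterate μ m c) ≡ true
                  → Σ ℕ λ k → Σ (Fin n) λ r → FirstHit μ P k c r × k < K
  firstHit-search zero c (suc m) _ () _
  firstHit-search (suc K) c m 1≤m m≤K hm with P (μ c) in hμc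
  ... | true = zero , μ c , hit hμc refl , s≤s z≤n
  firstHit-search (suc K) c (suc zero) _ _ hm | false = contradictionᵇ hm hμc
  firstHit-search (suc K) c (suc (suc m)) _ (s≤s m≤K) hm | false
    with firstHit-search K (μ c) (suc m) (s≤s z≤n) m≤K hm
  ... | k , r , p , k<K = suc k , r , skip hμc p , s≤s k<K

  restrict-next : ∀ a → P (μ a) ≡ true → restrict μ P a ≡ μ a
  restrict-next a h = restrictAux-firstHit (hit h refl) n a (≤-trans (s≤s z≤n) (toℕ<n a))

  module _ {D : Fin n → Bool} (pμ : IsPermutationOn D μ) where

    restrict-firstHit : ∀ a → D a ≡ true → P a ≡ true → Σ ℕ λ k → FirstHit μ P k a (restrict μ P a)
    restrict-firstHit a ha hP with iterate-returns pμ a ha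
    ... | d , 1≤d , d≤n , ret with firstHit-search n a d 1≤d d≤n (subst (λ t → P t ≡ true) (sym ret) hP)
    ... | k , r , p , k<n rewrite restrictAux-firstHit p n a k<n = k , p

    restrict-≡ : ∀ a → D a ≡ true → P a ≡ true → ∀ {k r} → FirstHit μ P k a r → restrict μ P a ≡ r
    restrict-≡ a ha hP = firstHit-unique (proj₂ (restrict-firstHit a ha hP))

    restrict-closed : ∀ a → D a ≡ true → P a ≡ true → P (restrict μ P a) ≡ true
    restrict-closed a ha hP = firstHit-∈ (proj₂ (restrict-firstHit a ha hP))

    module _ (P⊆D : ∀ b → P b ≡ true → D b ≡ true) where

      -- a = μ^(k'-k) a' lies in P, while a' meets P only after k'+1 steps; so k' - k = 0.
      firstHit-injective-≤ : ∀ {k k' a a' r} → FirstHit μ P k a r → FirstHit μ P k' a' r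
                           → P a ≡ true → P a' ≡ true → k ≤ k' → a ≡ a'
      firstHit-injective-≤ {k} {k'} {a} {a'} p q ha ha' k≤k' = returns-early d a≡μᵈa' (m∸n≤m k' k)
        where
        d : ℕ
        d = k' ∸ k
        same-end : iterate μ (suc k) a ≡ iterate μ (suc k) (iterate μ d a')
        same-end = begin
          iterate μ (suc k) a                 ≡⟨ trans (sym (firstHit-iterate p)) (firstHit-iterate q) ⟩
          iterate μ (suc k') a'               ≡⟨ cong (λ m → iterate μ m a') (sym (trans (+-suc d k) (cong suc (trans (+-comm d k) (m+[n∸m]≡n k≤k'))))) ⟩
          iterate μ (d + suc k) a'            ≡⟨ iterate-+ μ d (suc k) a' ⟩
          iterate μ (suc k) (iterate μ d a')  ∎
          where open ≡-Reasoning
        a≡μᵈa' : a ≡ iterate μ d a'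
        a≡μᵈa' = iterate-injective pμ (suc k) a _ (P⊆D a ha) (iterate-closed pμ d a' (P⊆D a' ha')) same-end
        returns-early : ∀ m → a ≡ iterate μ m a' → m ≤ k' → a ≡ a'
        returns-early zero    e _   = e
        returns-early (suc m) e 1+m≤k' =
          contradictionᵇ (trans (cong P (sym e)) ha) (firstHit-avoids q (suc m) (s≤s z≤n) 1+m≤k')

      firstHit-injective : ∀ {k k' a a' r} → FirstHit μ P k a r → FirstHit μ P k' a' r
                         → P a ≡ true → P a' ≡ true → a ≡ a'
      firstHit-injective {k} {k'} p q ha ha' with ≤-total k k'
      ... | inj₁ k≤k' = firstHit-injective-≤ p q ha ha' k≤k'
      ... | inj₂ k'≤k = sym (firstHit-injective-≤ q p ha' ha k'≤k)

      restrict-permutation : IsPermutationOn P (restrict μ P)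
      restrict-permutation = record
        { closed    = λ b hb → restrict-closed b (P⊆D b hb) hb
        ; injective = λ b c hb hc e →
            let (_ , p) = restrict-firstHit b (P⊆D b hb) hb
                (_ , q) = restrict-firstHit c (P⊆D c hc) hc
            in firstHit-injective p (subst (FirstHit μ P _ c) (sym e) q) hb hc
        }

-- Connectivity

module _ {Bs : Fin n → Bool} {σ α : Fin n → Fin n} {E : Fin n → Bool} where

  Conn-trans : ∀ {b c d} → Conn Bs σ α E b c → Conn Bs σ α E c d → Conn Bs σ α E b d
  Conn-trans done          q = q
  Conn-trans (σ-fwd h p)   q = σ-fwd h (Conn-trans p q)
  Conn-trans (σ-bwd h p)   q = σ-bwd h (Conn-trans p q)
  Conn-trans (α-fwd h e p) q = α-fwd h e (Conn-trans p q)
  Conn-trans (α-bwd h e p) q = α-bwd h e (Conn-trans p q)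

  Conn-sym : ∀ {b c} → Conn Bs σ α E b c → Conn Bs σ α E c b
  Conn-sym done          = done
  Conn-sym (σ-fwd h p)   = Conn-trans (Conn-sym p) (σ-bwd h done)
  Conn-sym (σ-bwd h p)   = Conn-trans (Conn-sym p) (σ-fwd h done)
  Conn-sym (α-fwd h e p) = Conn-trans (Conn-sym p) (α-bwd h e done)
  Conn-sym (α-bwd h e p) = Conn-trans (Conn-sym p) (α-fwd h e done)

  Conn-invariant : (S : Fin n → Set)
    → (∀ b → Bs b ≡ true → S b → S (σ b))
    → (∀ b → Bs b ≡ true → S (σ b) → S b)
    → (∀ b → Bs b ≡ true → E b ≡ false → S b → S (α b))
    → (∀ b → Bs b ≡ true → E b ≡ false → S (α b) → S b)
    → ∀ {b c} → Conn Bs σ α E b c → S b → S c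
  Conn-invariant S σ⁺ σ⁻ α⁺ α⁻ = go
    where
    go : ∀ {b c} → Conn Bs σ α E b c → S b → S c
    go done          s = s
    go (σ-fwd h p)   s = go p (σ⁺ _ h s)
    go (σ-bwd h p)   s = go p (σ⁻ _ h s)
    go (α-fwd h e p) s = go p (α⁺ _ h e s)
    go (α-bwd h e p) s = go p (α⁻ _ h e s)

Conn-transport : ∀ {Bs Bs' : Fin n → Bool} {σ σ' α α' : Fin n → Fin n} {E E' : Fin n → Bool}
  → (∀ b → Bs b ≡ Bs' b) → (∀ b → Bs b ≡ true → σ b ≡ σ' b) → (∀ b → Bs b ≡ true → α b ≡ α' b)
  → (∀ b → Bs b ≡ true → E b ≡ E' b)
  → ∀ {b c} → Conn Bs σ α E b c → Conn Bs' σ' α' E' b c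
Conn-transport {n = n} {Bs = Bs} {Bs'} {σ} {σ'} {α} {α'} {E} {E'} eB eσ eα eE = go
  where
  C' : Fin n → Fin n → Set
  C' = Conn Bs' σ' α' E'
  go : ∀ {b c} → Conn Bs σ α E b c → C' b c
  go done = done
  go (σ-fwd {b} {c} h p) =
    σ-fwd (trans (sym (eB b)) h) (subst (λ z → C' z c) (eσ b h) (go p))
  go (σ-bwd {b} {c} h p) =
    subst (λ z → C' z c) (sym (eσ b h)) (σ-bwd (trans (sym (eB b)) h) (go p))
  go (α-fwd {b} {c} h e p) =
    α-fwd (trans (sym (eB b)) h) (trans (sym (eE b h)) e) (subst (λ z → C' z c) (eα b h) (go p))
  go (α-bwd {b} {c} h e p) =
    subst (λ z → C' z c) (sym (eα b h)) (α-bwd (trans (sym (eB b)) h) (trans (sym (eE b h)) e) (go p))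

-- A σ-step b ↦ σ b is the α-step to α b followed by the (σα)-step to σ b.
Conn-dual : ∀ {Bs : Fin n → Bool} {σ α} → IsFpfInvolutionOn Bs α → ∀ {b c}
  → Conn Bs σ α (λ _ → false) b c → Conn Bs (σ ∘ₚ α) α (λ _ → false) b c
Conn-dual {n = n} {Bs = Bs} {σ} {α} iα = go
  where
  C' : Fin n → Fin n → Set
  C' = Conn Bs (σ ∘ₚ α) α (λ _ → false)
  σ-step : ∀ {b} → Bs b ≡ true → C' b (σ b)
  σ-step {b} h = α-fwd h refl (σ-fwd (inv-closed iα b h)
                   (subst (λ t → C' (σ t) (σ b)) (sym (involutive iα b h)) done))
  go : ∀ {b c} → Conn Bs σ α (λ _ → false) b c → C' b c
  go done          = done
  go (σ-fwd h p)   = Conn-trans (σ-step h) (go p)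
  go (σ-bwd h p)   = Conn-trans (Conn-sym (σ-step h)) (go p)
  go (α-fwd h e p) = α-fwd h e (go p)
  go (α-bwd h e p) = α-bwd h e (go p)

-- Edges and their deletion

∧-not-intro : ∀ {p q : Bool} → p ≡ true → q ≡ false → p ∧ not q ≡ true
∧-not-intro refl refl = refl

∧-not-elimˡ : ∀ {p q : Bool} → p ∧ not q ≡ true → p ≡ true
∧-not-elimˡ {true} {false} _ = refl

∧-not-elimʳ : ∀ {p q : Bool} → p ∧ not q ≡ true → q ≡ false
∧-not-elimʳ {true} {false} _ = refl

∧-not-false : ∀ {p q : Bool} → q ≡ true → p ∧ not q ≡ false
∧-not-false {true}  refl = refl
∧-not-false {false} refl = refl

∧-not-false⇒ : ∀ {p q : Bool} → p ≡ true → p ∧ not q ≡ false → q ≡ true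
∧-not-false⇒ {true} {true} _ _ = refl

module Edge (K : RawMap n) (iK : IsFpfInvolutionOn (B K) (α K)) (y : Fin n) (yB : y ∈B K) where

  E : Fin n → Bool
  E = edgeOf K y

  B∖E : Fin n → Bool
  B∖E = removeEdge K y

  E-cases : ∀ b → E b ≡ true → b ≡ y ⊎ b ≡ α K y
  E-cases b h with b ≟ y | b ≟ α K y
  ... | yes p | _     = inj₁ p
  ... | no _  | yes q = inj₂ q

  E-self : E y ≡ true
  E-self with y ≟ y
  ... | yes _ = refl
  ... | no y≢y = ⊥-elim (y≢y refl)

  E-partner : E (α K y) ≡ true
  E-partner with α K y ≟ y | α K y ≟ α K y
  ... | yes _ | _     = refl
  ... | no _  | yes _ = refl
  ... | no _  | no αy≢αy = ⊥-elim (αy≢αy refl)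

  E⊆B : ∀ b → E b ≡ true → B K b ≡ true
  E⊆B b h with E-cases b h
  ... | inj₁ refl = yB
  ... | inj₂ refl = inv-closed iK y yB

  E-α : ∀ b → E b ≡ true → E (α K b) ≡ true
  E-α b h with E-cases b h
  ... | inj₁ refl = E-partner
  ... | inj₂ refl = subst (λ z → E z ≡ true) (sym (involutive iK y yB)) E-self

  E-α⁻ : ∀ b → B K b ≡ true → E (α K b) ≡ true → E b ≡ true
  E-α⁻ b hb h = subst (λ z → E z ≡ true) (involutive iK b hb) (E-α _ h)

  E-α-false : ∀ b → B K b ≡ true → E b ≡ false → E (α K b) ≡ false
  E-α-false b hb h with E (α K b) in eq
  ... | false = refl
  ... | true  = contradictionᵇ (E-α⁻ b hb eq) h

  E-cases-from : ∀ u → E u ≡ true → ∀ b → E b ≡ true → b ≡ u ⊎ b ≡ α K u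
  E-cases-from u hu b hb with E-cases u hu | E-cases b hb
  ... | inj₁ refl | r         = r
  ... | inj₂ refl | inj₁ refl = inj₂ (sym (involutive iK y yB))
  ... | inj₂ refl | inj₂ refl = inj₁ refl

  B∖E⊆B : ∀ b → B∖E b ≡ true → B K b ≡ true
  B∖E⊆B b = ∧-not-elimˡ

  B∖E-∉E : ∀ b → B∖E b ≡ true → E b ≡ false
  B∖E-∉E b = ∧-not-elimʳ

  B∖E-complement : ∀ b → B K b ≡ true → B∖E b ≡ false → E b ≡ true
  B∖E-complement b = ∧-not-false⇒

  B∖E-α : ∀ b → B∖E b ≡ true → B∖E (α K b) ≡ true
  B∖E-α b h = ∧-not-intro (inv-closed iK b (B∖E⊆B b h)) (E-α-false b (B∖E⊆B b h) (B∖E-∉E b h))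

  E-forward-closed : ∀ (μ : Fin n → Fin n) z → E z ≡ true → E (μ z) ≡ true → E (μ (α K z)) ≡ true
                   → ∀ b → E b ≡ true → E (μ b) ≡ true
  E-forward-closed μ z hz hμz hμαz b hb with E-cases-from z hz b hb
  ... | inj₁ refl = hμz
  ... | inj₂ refl = hμαz

  E-backward-closed : ∀ {D μ} → IsPermutationOn D μ → (∀ b → E b ≡ true → D b ≡ true)
                    → ∀ z → E z ≡ true → E (μ z) ≡ true → E (μ (α K z)) ≡ true
                    → ∀ b → D b ≡ true → E (μ b) ≡ true → E b ≡ true
  E-backward-closed {μ = μ} pμ E⊆D z hz hμz hμαz b hb hμb
    with E-cases-from (μ z) hμz (μ b) hμb | E-cases-from (μ z) hμz (μ (α K z)) hμαz
  ... | inj₁ μb≡μz | _ = subst (λ t → E t ≡ true) (sym (injective pμ b z hb (E⊆D z hz) μb≡μz)) hz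
  ... | inj₂ μb≡αμz | inj₂ μαz≡αμz =
    subst (λ t → E t ≡ true)
      (sym (injective pμ b (α K z) hb (E⊆D _ (E-α z hz)) (trans μb≡αμz (sym μαz≡αμz)))) (E-α z hz)
  ... | inj₂ _ | inj₁ μαz≡μz =
    ⊥-elim (fixpoint-free iK z (E⊆B z hz) (injective pμ _ z (E⊆D _ (E-α z hz)) (E⊆D z hz) μαz≡μz))

  restrict-α : ∀ b → B∖E b ≡ true → restrict (α K) B∖E b ≡ α K b
  restrict-α b h = restrict-next b (B∖E-α b h)

  restrict-α-involution : IsFpfInvolutionOn B∖E (restrict (α K) B∖E)
  restrict-α-involution = record
    { inv-closed    = λ b h → subst (λ z → B∖E z ≡ true) (sym (restrict-α b h)) (B∖E-α b h)
    ; involutive    = λ b h → trans (cong (restrict (α K) B∖E) (restrict-α b h))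
                                (trans (restrict-α _ (B∖E-α b h)) (involutive iK b (B∖E⊆B b h)))
    ; fixpoint-free = λ b h e → fixpoint-free iK b (B∖E⊆B b h) (trans (sym (restrict-α b h)) e)
    }

  restrict-permutationᴮ : ∀ {μ} → IsPermutationOn (B K) μ → IsPermutationOn B∖E (restrict μ B∖E)
  restrict-permutationᴮ pμ = restrict-permutation pμ B∖E⊆B

  edgeOf-cong : ∀ (K' : RawMap n) → α K' y ≡ α K y → ∀ b → edgeOf K' y b ≡ E b
  edgeOf-cong K' e b = cong (λ z → ⌊ b ≟ y ⌋ ∨ ⌊ b ≟ z ⌋) e

module Deletion (K : RawMap n) (pK : IsPermutationOn (B K) (σ K)) (iK : IsFpfInvolutionOn (B K) (α K))
                (y : Fin n) (yB : y ∈B K) where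
  open Edge K iK y yB public

  σ∖ α∖ : Fin n → Fin n
  σ∖ = restrict (σ K) B∖E
  α∖ = restrict (α K) B∖E

  ConnK Conn∖ : Fin n → Fin n → Set
  ConnK = Conn (B K) (σ K) (α K) E
  Conn∖ = Conn B∖E σ∖ α∖ (λ _ → false)

  firstHit-Conn : ∀ {k b r} → FirstHit (σ K) B∖E k b r → B K b ≡ true → ConnK b r
  firstHit-Conn (hit _ e)  hb = σ-fwd hb (subst (ConnK _) e done)
  firstHit-Conn (skip _ p) hb = σ-fwd hb (firstHit-Conn p (closed pK _ hb))

  σ∖-Conn : ∀ b → B∖E b ≡ true → ConnK b (σ∖ b)
  σ∖-Conn b h = firstHit-Conn (proj₂ (restrict-firstHit pK b (B∖E⊆B b h) h)) (B∖E⊆B b h)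

  Conn∖⇒Conn : ∀ {E' : Fin n → Bool} {b c} → Conn B∖E σ∖ α∖ E' b c → ConnK b c
  Conn∖⇒Conn done          = done
  Conn∖⇒Conn (σ-fwd h p)   = Conn-trans (σ∖-Conn _ h) (Conn∖⇒Conn p)
  Conn∖⇒Conn (σ-bwd h p)   = Conn-trans (Conn-sym (σ∖-Conn _ h)) (Conn∖⇒Conn p)
  Conn∖⇒Conn (α-fwd {b} {c} h _ p) =
    α-fwd (B∖E⊆B b h) (B∖E-∉E b h) (subst (λ z → ConnK z c) (restrict-α b h) (Conn∖⇒Conn p))
  Conn∖⇒Conn (α-bwd {b} {c} h _ p) =
    subst (λ z → ConnK z c) (sym (restrict-α b h)) (α-bwd (B∖E⊆B b h) (B∖E-∉E b h) (Conn∖⇒Conn p))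

  trapped : (S : Fin n → Set) → (∀ b → S b → E b ≡ true)
          → (∀ b → B K b ≡ true → S b → S (σ K b))
          → (∀ b → B K b ≡ true → S (σ K b) → S b)
          → ∀ {u w} → ConnK u w → S u → S w
  trapped S S⊆E σ⁺ σ⁻ = Conn-invariant S σ⁺ σ⁻
    (λ b _ b∉E s → contradictionᵇ (S⊆E b s) b∉E)
    (λ b hb b∉E s → contradictionᵇ (E-α⁻ b hb (S⊆E _ s)) b∉E)

  E-fixpoint-trapped : ∀ u → B K u ≡ true → E u ≡ true → σ K u ≡ u → ∀ {w} → ConnK u w → w ≡ u
  E-fixpoint-trapped u uB hu σu≡u p = trapped (λ b → b ≡ u) (λ { _ refl → hu })
    (λ b _ b≡u → trans (cong (σ K) b≡u) σu≡u)
    (λ b hb σb≡u → injective pK b u hb uB (trans σb≡u (sym σu≡u)))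
    p refl

  E-swap-trapped : ∀ u → E u ≡ true → σ K u ≡ α K u → σ K (α K u) ≡ u → ∀ {w} → ConnK u w → E w ≡ true
  E-swap-trapped u hu σu≡αu σαu≡u p = trapped (λ b → E b ≡ true) (λ _ h → h)
    (λ b _ → E-forward-closed (σ K) u hu hσu hσαu b) (E-backward-closed pK E⊆B u hu hσu hσαu)
    p hu
    where
    hσu : E (σ K u) ≡ true
    hσu = subst (λ t → E t ≡ true) (sym σu≡αu) (E-α u hu)
    hσαu : E (σ K (α K u)) ≡ true
    hσαu = subst (λ t → E t ≡ true) (sym σαu≡u) hu

  -- The σ-orbit of a flag of the edge leaves the edge, unless the edge is a whole component.
  leaves-E : ∀ w → B∖E w ≡ true → (∀ u → B K u ≡ true → ConnK u w)
           → ∀ u → E u ≡ true → Σ (Fin n) λ r → Σ ℕ λ k → FirstHit (σ K) B∖E k u r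
  leaves-E w hw u⇝w u hu = go (E⊆B u hu)
    where
    go : B K u ≡ true → Σ (Fin n) λ r → Σ ℕ λ k → FirstHit (σ K) B∖E k u r
    go uB with B∖E (σ K u) in h₁
    ... | true = σ K u , zero , hit h₁ refl
    ... | false with E-cases-from u hu (σ K u) (B∖E-complement _ (closed pK u uB) h₁)
    ... | inj₁ σu≡u =
      contradictionᵇ (subst (λ t → E t ≡ true) (sym (E-fixpoint-trapped u uB hu σu≡u (u⇝w u uB))) hu)
                     (B∖E-∉E w hw)
    ... | inj₂ σu≡αu with B∖E (σ K (α K u)) in h₂
    ... | true = σ K (α K u) , suc zero ,
                 skip h₁ (hit (subst (λ t → B∖E (σ K t) ≡ true) (sym σu≡αu) h₂) (cong (σ K) σu≡αu))
    ... | false with E-cases-from u hu (σ K (α K u)) (B∖E-complement _ (closed pK _ (inv-closed iK u uB)) h₂)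
    ... | inj₁ σαu≡u = contradictionᵇ (E-swap-trapped u hu σu≡αu σαu≡u (u⇝w u uB)) (B∖E-∉E w hw)
    ... | inj₂ σαu≡αu = ⊥-elim (fixpoint-free iK u uB
            (sym (injective pK u (α K u) uB (inv-closed iK u uB) (trans σu≡αu (sym σαu≡αu)))))

  Rep : Fin n → Fin n → Set
  Rep u u' = (B∖E u ≡ true × u' ≡ u) ⊎ (E u ≡ true × Σ ℕ λ k → FirstHit (σ K) B∖E k u u')

  Rep-unique : ∀ {u u₁ u₂} → Rep u u₁ → Rep u u₂ → u₁ ≡ u₂
  Rep-unique (inj₁ (_ , e₁))     (inj₁ (_ , e₂))     = trans e₁ (sym e₂)
  Rep-unique (inj₁ (h , _))      (inj₂ (h' , _))     = contradictionᵇ h' (B∖E-∉E _ h)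
  Rep-unique (inj₂ (h , _))      (inj₁ (h' , _))     = contradictionᵇ h (B∖E-∉E _ h')
  Rep-unique (inj₂ (_ , _ , p))  (inj₂ (_ , _ , q))  = firstHit-unique p q

  Rep-σ : ∀ {u u' v'} → B K u ≡ true → Rep u u' → Rep (σ K u) v' → Conn∖ u' v'
  Rep-σ {u} hu (inj₁ (h , refl)) (inj₁ (hσ , refl)) =
    σ-fwd h (subst (λ z → Conn∖ z (σ K u)) (sym (restrict-next u hσ)) done)
  Rep-σ {u} {v' = v'} hu (inj₁ (h , refl)) (inj₂ (hσ , _ , p)) =
    σ-fwd h (subst (λ z → Conn∖ z v') (sym (restrict-≡ pK u hu h (skip (∧-not-false hσ) p))) done)
  Rep-σ {u} hu (inj₂ (_ , _ , p)) (inj₁ (hσ , refl)) =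
    subst (λ z → Conn∖ z (σ K u)) (sym (firstHit-unique p (hit hσ refl))) done
  Rep-σ {u} {v' = v'} hu (inj₂ (_ , _ , p)) (inj₂ (hσ , _ , q)) =
    subst (λ z → Conn∖ z v') (sym (firstHit-unique p (skip (∧-not-false hσ) q))) done

  Rep-α : ∀ {u u' v'} → B K u ≡ true → E u ≡ false → Rep u u' → Rep (α K u) v' → Conn∖ u' v'
  Rep-α {u} hu u∉E ru rv = subst₂ Conn∖ (Rep-unique (inj₁ (h , refl)) ru) (Rep-unique (inj₁ (hα , refl)) rv)
      (α-fwd h refl (subst (λ z → Conn∖ z (α K u)) (sym (restrict-next u hα)) done))
    where
    h : B∖E u ≡ true
    h = ∧-not-intro hu u∉E
    hα : B∖E (α K u) ≡ true
    hα = B∖E-α u h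

  module _ (cw : ConnectedWithout K y) where

    deletion-connected : ∀ b c → B∖E b ≡ true → B∖E c ≡ true → Conn∖ b c
    deletion-connected b c hb hc =
      lift (cw b c (B∖E⊆B b hb) (B∖E⊆B c hc)) (B∖E⊆B b hb) (inj₁ (hb , refl)) (inj₁ (hc , refl))
      where
      Rep-exists : ∀ u → B K u ≡ true → Σ (Fin n) (Rep u)
      Rep-exists u hu with B∖E u in h
      ... | true  = u , inj₁ (refl , refl)
      ... | false with leaves-E b hb (λ u hu → cw u b hu (B∖E⊆B b hb)) u (B∖E-complement u hu h)
      ... | r , k , p = r , inj₂ (B∖E-complement u hu h , k , p)

      lift : ∀ {u v} → ConnK u v → B K u ≡ true → ∀ {u' v'} → Rep u u' → Rep v v' → Conn∖ u' v'
      lift done hu ru rv = subst (Conn∖ _) (Rep-unique ru rv) done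
      lift (σ-fwd {u} h p) hu ru rv with Rep-exists (σ K u) (closed pK u h)
      ... | _ , rw = Conn-trans (Rep-σ h ru rw) (lift p (closed pK u h) rw rv)
      lift (σ-bwd {u} h p) hu ru rv with Rep-exists u h
      ... | _ , rw = Conn-trans (Conn-sym (Rep-σ h rw ru)) (lift p h rw rv)
      lift (α-fwd {u} h e p) hu ru rv with Rep-exists (α K u) (inv-closed iK u h)
      ... | _ , rw = Conn-trans (Rep-α h e ru rw) (lift p (inv-closed iK u h) rw rv)
      lift (α-bwd {u} h e p) hu ru rv with Rep-exists u h
      ... | _ , rw = Conn-trans (Conn-sym (Rep-α h e rw ru)) (lift p h rw rv)

-- Two distinct edges

module TwoEdges (M : RawMap n) (isM : IsMap M) (x y : Fin n) (xB : x ∈B M) (yB : y ∈B M)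
                (y≢x : ¬ y ≡ x) (y≢αx : ¬ y ≡ α M x) where
  open IsMap isM

  φ : Fin n → Fin n
  φ = σ M ∘ₚ α M

  pσ : IsPermutationOn (B M) (σ M)
  pσ = record { closed = σ-closed ; injective = σ-inj }

  iα : IsFpfInvolutionOn (B M) (α M)
  iα = record { inv-closed = α-closed ; involutive = α-invol ; fixpoint-free = α-fpf }

  pα : IsPermutationOn (B M) (α M)
  pα = involution⇒permutation iα

  pφ : IsPermutationOn (B M) φ
  pφ = ∘-permutation pσ pα

  module EX = Edge M iα x xB
  module EY = Edge M iα y yB

  E F B₁ B₂ : Fin n → Bool
  E  = EX.E
  F  = EY.E
  B₁ = EX.B∖E
  B₂ = EY.B∖E

  F⇒∉E : ∀ b → F b ≡ true → E b ≡ false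
  F⇒∉E b hF with E b in hE
  ... | false = refl
  ... | true with EX.E-cases b hE | EY.E-cases b hF
  ... | inj₁ refl | inj₁ y≡x  = ⊥-elim (y≢x (sym y≡x))
  ... | inj₁ refl | inj₂ x≡αy = ⊥-elim (y≢αx (trans (sym (α-invol y yB)) (cong (α M) (sym x≡αy))))
  ... | inj₂ refl | inj₁ αx≡y = ⊥-elim (y≢αx (sym αx≡y))
  ... | inj₂ refl | inj₂ αx≡αy = ⊥-elim (y≢x (sym (injective pα x y xB yB αx≡αy)))

  E⇒∉F : ∀ b → E b ≡ true → F b ≡ false
  E⇒∉F b hE with F b in hF
  ... | false = refl
  ... | true  = contradictionᵇ hE (F⇒∉E b hF)

  F⊆B₁ : ∀ b → F b ≡ true → B₁ b ≡ true
  F⊆B₁ b h = ∧-not-intro (EY.E⊆B b h) (F⇒∉E b h)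

  E⊆B₂ : ∀ b → E b ≡ true → B₂ b ≡ true
  E⊆B₂ b h = ∧-not-intro (EX.E⊆B b h) (E⇒∉F b h)

  M₁ M₂ : RawMap n
  M₁ = delete M x
  M₂ = contract M y

  σ₁ α₁ φ₁ σ₂ α₂ : Fin n → Fin n
  σ₁ = σ M₁
  α₁ = α M₁
  φ₁ = σ₁ ∘ₚ α₁
  σ₂ = σ M₂
  α₂ = α M₂

  pφ₁ : IsPermutationOn B₁ φ₁
  pφ₁ = ∘-permutation (EX.restrict-permutationᴮ pσ) (involution⇒permutation EX.restrict-α-involution)

  pσ₂ : IsPermutationOn B₂ σ₂
  pσ₂ = ∘-permutation (EY.restrict-permutationᴮ pφ) (involution⇒permutation EY.restrict-α-involution)

  F₁≡F : ∀ b → edgeOf M₁ y b ≡ F b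
  F₁≡F = EY.edgeOf-cong M₁ (EX.restrict-α y (F⊆B₁ y EY.E-self))

  E₂≡E : ∀ b → edgeOf M₂ x b ≡ E b
  E₂≡E = EX.edgeOf-cong M₂ (EY.restrict-α x (E⊆B₂ x EX.E-self))

  Conn* : Fin n → Fin n → Set
  Conn* = Conn (B M) φ (α M) F

  -- For t on e, σ t = φ (α t), and the dual step across e is allowed in M* − f since e ≠ f.
  firstHit-Conn* : ∀ {k c r} → FirstHit (σ M) B₁ k c r → B M c ≡ true → Conn* (σ M c) r
  firstHit-Conn* (hit _ e) _ = subst (Conn* _) e done
  firstHit-Conn* {c = c} {r} (skip h p) hc =
    α-fwd σcB (E⇒∉F (σ M c) (EX.B∖E-complement (σ M c) σcB h))
      (σ-fwd (α-closed _ σcB) (subst (λ t → Conn* (σ M t) r) (sym (α-invol _ σcB)) (firstHit-Conn* p σcB)))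
    where
    σcB : B M (σ M c) ≡ true
    σcB = σ-closed c hc

  φ₁-Conn* : ∀ d → B₁ d ≡ true → Conn* d (φ₁ d)
  φ₁-Conn* d hd = σ-fwd dB (subst (λ t → Conn* (φ d) (σ₁ t)) (sym (EX.restrict-α d hd))
                    (firstHit-Conn* (proj₂ (restrict-firstHit pσ (α M d) (α-closed d dB) (EX.B∖E-α d hd)))
                                    (α-closed d dB)))
    where
    dB : B M d ≡ true
    dB = EX.B∖E⊆B d hd

  Conn*₁⇒Conn* : ∀ {b c} → Conn B₁ φ₁ α₁ (edgeOf M₁ y) b c → Conn* b c
  Conn*₁⇒Conn* done        = done
  Conn*₁⇒Conn* (σ-fwd h p) = Conn-trans (φ₁-Conn* _ h) (Conn*₁⇒Conn* p)
  Conn*₁⇒Conn* (σ-bwd h p) = Conn-trans (Conn-sym (φ₁-Conn* _ h)) (Conn*₁⇒Conn* p)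
  Conn*₁⇒Conn* (α-fwd {d} {c} h e p) =
    α-fwd (EX.B∖E⊆B d h) (trans (sym (F₁≡F d)) e) (subst (λ z → Conn* z c) (EX.restrict-α d h) (Conn*₁⇒Conn* p))
  Conn*₁⇒Conn* (α-bwd {d} {c} h e p) =
    subst (λ z → Conn* z c) (sym (EX.restrict-α d h)) (α-bwd (EX.B∖E⊆B d h) (trans (sym (F₁≡F d)) e) (Conn*₁⇒Conn* p))

  E-not-σ-closed : ∀ z → E z ≡ true → E (σ M z) ≡ true → E (σ M (α M z)) ≡ true → ⊥
  E-not-σ-closed z hz hσz hσαz = contradictionᵇ
    (Conn-invariant (λ b → E b ≡ true)
       (λ b _ → EX.E-forward-closed (σ M) z hz hσz hσαz b)
       (EX.E-backward-closed pσ EX.E⊆B z hz hσz hσαz)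
       (λ b _ _ → EX.E-α b) (λ b hb _ → EX.E-α⁻ b hb)
       (transitive z y (EX.E⊆B z hz) yB) hz)
    (F⇒∉E y EY.E-self)

  E-Conn*-B₁ : ∀ z → E z ≡ true → Σ (Fin n) λ w → B₁ w ≡ true × Conn* z w
  E-Conn*-B₁ z hz = go (EX.E⊆B z hz)
    where
    go : B M z ≡ true → Σ (Fin n) λ w → B₁ w ≡ true × Conn* z w
    go zB with B₁ (φ z) in h₁ | B₁ (σ M z) in h₂
    ... | true  | _     = φ z , h₁ , σ-fwd zB done
    ... | false | true  = σ M z , h₂ , α-fwd zB (E⇒∉F z hz)
                            (σ-fwd (α-closed z zB) (subst (λ t → Conn* (σ M t) (σ M z)) (sym (α-invol z zB)) done))
    ... | false | false = ⊥-elim (E-not-σ-closed z hz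
                            (EX.B∖E-complement _ (σ-closed z zB) h₂) (EX.B∖E-complement _ (σ-closed _ (α-closed z zB)) h₁))

  dual-delete-connected⇒dual-connected : ConnectedWithout (dual M₁) y → ConnectedWithout (dual M) y
  dual-delete-connected⇒dual-connected c₁ b c hb hc with to-B₁ b hb | to-B₁ c hc
    where
    to-B₁ : ∀ b → B M b ≡ true → Σ (Fin n) λ w → B₁ w ≡ true × Conn* b w
    to-B₁ b hb with B₁ b in h
    ... | true  = b , h , done
    ... | false = E-Conn*-B₁ b (EX.B∖E-complement b hb h)
  ... | wb , hwb , pb | wc , hwc , pc = Conn-trans pb (Conn-trans (Conn*₁⇒Conn* (c₁ wb wc hwb hwc)) (Conn-sym pc))

  N Q : RawMap n
  N = contract M₁ y
  Q = delete M₂ x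

  C : Fin n → Bool
  C = B N

  C-eq : ∀ b → C b ≡ (B M b ∧ not (E b)) ∧ not (F b)
  C-eq b = cong (λ t → B₁ b ∧ not t) (F₁≡F b)

  B-Q≡C : ∀ b → B Q b ≡ C b
  B-Q≡C b = begin
    B₂ b ∧ not (edgeOf M₂ x b)        ≡⟨ cong (λ t → B₂ b ∧ not t) (E₂≡E b) ⟩
    (B M b ∧ not (F b)) ∧ not (E b)   ≡⟨ ∧-not-swap (B M b) (F b) (E b) ⟩
    (B M b ∧ not (E b)) ∧ not (F b)   ≡⟨ sym (C-eq b) ⟩
    C b                               ∎
    where
    open ≡-Reasoning
    ∧-not-swap : ∀ p q r → (p ∧ not q) ∧ not r ≡ (p ∧ not r) ∧ not q
    ∧-not-swap true  true  true  = refl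
    ∧-not-swap true  true  false = refl
    ∧-not-swap true  false true  = refl
    ∧-not-swap true  false false = refl
    ∧-not-swap false _     _     = refl

  C⊆B₁ : ∀ b → C b ≡ true → B₁ b ≡ true
  C⊆B₁ b h = ∧-not-elimˡ h

  C⊆B : ∀ b → C b ≡ true → B M b ≡ true
  C⊆B b h = ∧-not-elimˡ (C⊆B₁ b h)

  C-∉E : ∀ b → C b ≡ true → E b ≡ false
  C-∉E b h = ∧-not-elimʳ (C⊆B₁ b h)

  C-∉F : ∀ b → C b ≡ true → F b ≡ false
  C-∉F b h = ∧-not-elimʳ (trans (sym (C-eq b)) h)

  C⊆B₂ : ∀ b → C b ≡ true → B₂ b ≡ true
  C⊆B₂ b h = ∧-not-intro (C⊆B b h) (C-∉F b h)

  C-intro : ∀ b → B M b ≡ true → E b ≡ false → F b ≡ false → C b ≡ true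
  C-intro b hB hE hF = trans (C-eq b) (∧-not-intro (∧-not-intro hB hE) hF)

  E⇒∉C : ∀ b → E b ≡ true → C b ≡ false
  E⇒∉C b h = trans (C-eq b) (cong (λ t → t ∧ not (F b)) (∧-not-false h))

  F⇒∉C : ∀ b → F b ≡ true → C b ≡ false
  F⇒∉C b h = trans (C-eq b) (∧-not-false h)

  ∉C⇒E⊎F : ∀ b → B M b ≡ true → C b ≡ false → E b ≡ true ⊎ F b ≡ true
  ∉C⇒E⊎F b hb h = split hb (trans (sym (C-eq b)) h)
    where
    split : ∀ {p q r} → p ≡ true → (p ∧ not q) ∧ not r ≡ false → q ≡ true ⊎ r ≡ true
    split {true} {true}          _ _ = inj₁ refl
    split {true} {false} {true}  _ _ = inj₂ refl

  C-α : ∀ b → C b ≡ true → C (α M b) ≡ true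
  C-α b h = C-intro (α M b) (α-closed b (C⊆B b h))
              (EX.E-α-false b (C⊆B b h) (C-∉E b h)) (EY.E-α-false b (C⊆B b h) (C-∉F b h))

  data Walk : Fin n → Fin n → Set where
    stop  : ∀ {u}   → C u ≡ true → Walk u u
    via-e : ∀ {u r} → E u ≡ true → Walk (σ M u) r → Walk u r
    via-f : ∀ {u r} → F u ≡ true → Walk (φ u) r → Walk u r

  walkStep : Fin n → Fin n
  walkStep u = if F u then φ u else σ M u

  walkStep-F : ∀ u → F u ≡ true → walkStep u ≡ φ u
  walkStep-F u h rewrite h = refl

  walkStep-∉F : ∀ u → F u ≡ false → walkStep u ≡ σ M u
  walkStep-∉F u h rewrite h = refl

  walkStep-permutation : IsPermutationOn (B M) walkStep
  walkStep-permutation = record { closed = closed′ ; injective = injective′ }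
    where
    closed′ : ∀ b → B M b ≡ true → B M (walkStep b) ≡ true
    closed′ b hb with F b
    ... | true  = σ-closed _ (α-closed b hb)
    ... | false = σ-closed b hb
    injective′ : ∀ b c → B M b ≡ true → B M c ≡ true → walkStep b ≡ walkStep c → b ≡ c
    injective′ b c hb hc e with F b in hFb | F c in hFc
    ... | true  | true  = injective pα b c hb hc (σ-inj _ _ (α-closed b hb) (α-closed c hc) e)
    ... | false | false = σ-inj b c hb hc e
    ... | false | true  = contradictionᵇ
          (subst (λ t → F t ≡ true) (sym (σ-inj b (α M c) hb (α-closed c hc) e)) (EY.E-α c hFc)) hFb
    ... | true  | false = contradictionᵇ
          (subst (λ t → F t ≡ true) (σ-inj (α M b) c (α-closed b hb) hc e) (EY.E-α b hFb)) hFc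

  firstHit-Walk : ∀ {k c r} → FirstHit walkStep C k c r → B M c ≡ true → Walk (walkStep c) r
  firstHit-Walk (hit h e) _ = subst (Walk _) e (stop h)
  firstHit-Walk {c = c} {r} (skip h p) hc with ∉C⇒E⊎F (walkStep c) (closed walkStep-permutation c hc) h
  ... | inj₁ hE = via-e hE (subst (λ t → Walk t r) (walkStep-∉F (walkStep c) (E⇒∉F (walkStep c) hE))
                             (firstHit-Walk p (closed walkStep-permutation c hc)))
  ... | inj₂ hF = via-f hF (subst (λ t → Walk t r) (walkStep-F (walkStep c) hF)
                             (firstHit-Walk p (closed walkStep-permutation c hc)))

  φ₁-prefix : ∀ {u} s → B₁ s ≡ true → Prefix (σ M) B₁ (α M s) u → B₁ u ≡ true → φ₁ s ≡ u
  φ₁-prefix s hs p hu = trans (cong σ₁ (EX.restrict-α s hs))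
    (restrict-≡ pσ (α M s) (α-closed s (EX.B∖E⊆B s hs)) (EX.B∖E-α s hs) (proj₂ (prefix-firstHit p hu)))

  σ₂-prefix : ∀ {u} s → B₂ s ≡ true → Prefix φ B₂ (α M s) u → B₂ u ≡ true → σ₂ s ≡ u
  σ₂-prefix s hs p hu = trans (cong (restrict φ B₂) (EY.restrict-α s hs))
    (restrict-≡ pφ (α M s) (α-closed s (EY.B∖E⊆B s hs)) (EY.B∖E-α s hs) (proj₂ (prefix-firstHit p hu)))

  walk-φ₁ : ∀ {u r} → Walk u r → ∀ s → B₁ s ≡ true → Prefix (σ M) B₁ (α M s) u → Σ ℕ λ k → FirstHit φ₁ C k s r
  walk-φ₁ (stop {u} hu) s hs p = zero , hit (subst (λ t → C t ≡ true) (sym φ₁s≡u) hu) φ₁s≡u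
    where
    φ₁s≡u : φ₁ s ≡ u
    φ₁s≡u = φ₁-prefix s hs p (C⊆B₁ u hu)
  walk-φ₁ (via-e hu w) s hs p = walk-φ₁ w s hs (prefix-extend p (∧-not-false hu))
  walk-φ₁ (via-f {u} hu w) s hs p with walk-φ₁ w u (F⊆B₁ u hu) first
  ... | k , q = suc k , firstHit-skip (φ₁-prefix s hs p (F⊆B₁ u hu)) (F⇒∉C u hu) q

  walk-σ₂ : ∀ {u r} → Walk u r → ∀ s → B₂ s ≡ true → Prefix φ B₂ (α M s) u → Σ ℕ λ k → FirstHit σ₂ (B Q) k s r
  walk-σ₂ (stop {u} hu) s hs p = zero , hit (subst (λ t → B Q t ≡ true) (sym σ₂s≡u) (trans (B-Q≡C u) hu)) σ₂s≡u
    where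
    σ₂s≡u : σ₂ s ≡ u
    σ₂s≡u = σ₂-prefix s hs p (C⊆B₂ u hu)
  walk-σ₂ (via-f hu w) s hs p = walk-σ₂ w s hs (prefix-extend p (∧-not-false hu))
  walk-σ₂ (via-e {u} hu w) s hs p
    with walk-σ₂ w u (E⊆B₂ u hu) (subst (Prefix φ B₂ (α M u)) (cong (σ M) (α-invol u (EX.E⊆B u hu))) first)
  ... | k , q = suc k , firstHit-skip (σ₂-prefix s hs p (E⊆B₂ u hu)) (trans (B-Q≡C u) (E⇒∉C u hu)) q

  contract-delete≡delete-contract : MapEq N Q
  contract-delete≡delete-contract = (λ b → sym (B-Q≡C b)) , λ b hb → σN≡σQ b hb , trans (α-N b hb) (sym (α-Q b hb))
    where
    α-N : ∀ b → C b ≡ true → α N b ≡ α M b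
    α-N b hb = trans (restrict-next b (subst (λ t → C t ≡ true) (sym (EX.restrict-α b (C⊆B₁ b hb))) (C-α b hb)))
                     (EX.restrict-α b (C⊆B₁ b hb))
    α-Q : ∀ b → C b ≡ true → α Q b ≡ α M b
    α-Q b hb = trans (restrict-next b (subst (λ t → B Q t ≡ true) (sym (EY.restrict-α b (C⊆B₂ b hb)))
                                        (trans (B-Q≡C _) (C-α b hb))))
                     (EY.restrict-α b (C⊆B₂ b hb))
    σN≡σQ : ∀ b → C b ≡ true → σ N b ≡ σ Q b
    σN≡σQ b hb = trans σN≡r (sym σQ≡r)
      where
      bB : B M b ≡ true
      bB = C⊆B b hb
      r : Fin n
      r = restrict walkStep C b
      walk : Walk (σ M b) r
      walk = subst (λ t → Walk t r) (walkStep-∉F b (C-∉F b hb))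
               (firstHit-Walk (proj₂ (restrict-firstHit walkStep-permutation b bB hb)) bB)
      back₁ : Prefix (σ M) B₁ (α M (α M b)) (σ M b)
      back₁ = subst (Prefix (σ M) B₁ (α M (α M b))) (cong (σ M) (α-invol b bB)) first
      back₂ : Prefix φ B₂ (α M b) (σ M b)
      back₂ = subst (Prefix φ B₂ (α M b)) (cong (σ M) (α-invol b bB)) first
      σN≡r : σ N b ≡ r
      σN≡r = trans (cong (restrict φ₁ C) (α-N b hb))
               (restrict-≡ pφ₁ (α M b) (EX.B∖E-α b (C⊆B₁ b hb)) (C-α b hb)
                 (proj₂ (walk-φ₁ walk (α M b) (EX.B∖E-α b (C⊆B₁ b hb)) back₁)))
      σQ≡r : σ Q b ≡ r
      σQ≡r = restrict-≡ pσ₂ b (C⊆B₂ b hb) (trans (B-Q≡C b) hb) (proj₂ (walk-σ₂ walk b (C⊆B₂ b hb) back₂))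

  module DX  = Deletion M pσ iα x xB
  module DY₁ = Deletion (dual M₁) pφ₁ EX.restrict-α-involution y (F⊆B₁ y EY.E-self)
  module DY  = Deletion (dual M) pφ iα y yB
  module DX₂ = Deletion M₂ pσ₂ EY.restrict-α-involution x (E⊆B₂ x EX.E-self)

  module _ (c₀ : ConnectedWithout M x) (c₁ : ConnectedWithout (dual M₁) y) where

    σz≢z : ∀ z → E z ≡ true → σ M z ≡ z → ⊥
    σz≢z z hz σz≡z = fixpoint-free iα z zB
      (DX.E-fixpoint-trapped z zB hz σz≡z (c₀ z (α M z) zB (α-closed z zB)))
      where
      zB : B M z ≡ true
      zB = EX.E⊆B z hz

    φ₁c≢c : ∀ c → F c ≡ true → φ₁ c ≡ c → ⊥
    φ₁c≢c c hc φ₁c≡c = fixpoint-free iα c (EY.E⊆B c hc)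
      (DY₁.E-fixpoint-trapped c hc₁ (trans (F₁≡F c) hc) φ₁c≡c (c₁ c (α M c) hc₁ (EX.B∖E-α c hc₁)))
      where
      hc₁ : B₁ c ≡ true
      hc₁ = F⊆B₁ c hc

    ¬[σz≡c×σαc≡z] : ∀ z c → E z ≡ true → F c ≡ true → σ M z ≡ c → σ M (α M c) ≡ z → ⊥
    ¬[σz≡c×σαc≡z] z c hz hc σz≡c σαc≡z = φ₁c≢c c hc (φ₁-prefix c hc₁ αc⇝c hc₁)
      where
      hc₁ : B₁ c ≡ true
      hc₁ = F⊆B₁ c hc
      αc⇝c : Prefix (σ M) B₁ (α M c) c
      αc⇝c = subst (Prefix (σ M) B₁ (α M c)) (trans (cong (σ M) σαc≡z) σz≡c)
               (prefix-extend first (subst (λ t → B₁ t ≡ false) (sym σαc≡z) (∧-not-false hz)))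

    -- {z, c, α c} would be closed under σ and under α-steps avoiding e, yet it does not contain α z.
    ¬[σz≡c×σc≡z×σαc≡αc] : ∀ z c → E z ≡ true → F c ≡ true
                        → σ M z ≡ c → σ M c ≡ z → σ M (α M c) ≡ α M c → ⊥
    ¬[σz≡c×σc≡z×σαc≡αc] z c hz hc σz≡c σc≡z σαc≡αc =
      outside (Conn-invariant S σ⁺ σ⁻ α⁺ α⁻ (c₀ z (α M z) zB (α-closed z zB)) (inj₁ refl))
      where
      zB : B M z ≡ true
      zB = EX.E⊆B z hz
      cB : B M c ≡ true
      cB = EY.E⊆B c hc
      S : Fin n → Set
      S b = b ≡ z ⊎ b ≡ c ⊎ b ≡ α M c
      σ⁺ : ∀ b → B M b ≡ true → S b → S (σ M b)
      σ⁺ b _ (inj₁ refl)        = inj₂ (inj₁ σz≡c)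
      σ⁺ b _ (inj₂ (inj₁ refl)) = inj₁ σc≡z
      σ⁺ b _ (inj₂ (inj₂ refl)) = inj₂ (inj₂ σαc≡αc)
      σ⁻ : ∀ b → B M b ≡ true → S (σ M b) → S b
      σ⁻ b hb (inj₁ e)        = inj₂ (inj₁ (σ-inj b c hb cB (trans e (sym σc≡z))))
      σ⁻ b hb (inj₂ (inj₁ e)) = inj₁ (σ-inj b z hb zB (trans e (sym σz≡c)))
      σ⁻ b hb (inj₂ (inj₂ e)) = inj₂ (inj₂ (σ-inj b (α M c) hb (α-closed c cB) (trans e (sym σαc≡αc))))
      α⁺ : ∀ b → B M b ≡ true → E b ≡ false → S b → S (α M b)
      α⁺ b _ b∉E (inj₁ refl)      = contradictionᵇ hz b∉E
      α⁺ b _ _ (inj₂ (inj₁ refl)) = inj₂ (inj₂ refl)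
      α⁺ b _ _ (inj₂ (inj₂ refl)) = inj₂ (inj₁ (α-invol c cB))
      α⁻ : ∀ b → B M b ≡ true → E b ≡ false → S (α M b) → S b
      α⁻ b hb b∉E (inj₁ e)        = contradictionᵇ (EX.E-α⁻ b hb (subst (λ t → E t ≡ true) (sym e) hz)) b∉E
      α⁻ b hb _   (inj₂ (inj₁ e)) = inj₂ (inj₂ (trans (sym (α-invol b hb)) (cong (α M) e)))
      α⁻ b hb _   (inj₂ (inj₂ e)) = inj₂ (inj₁ (injective pα b c hb cB e))
      outside : S (α M z) → ⊥
      outside (inj₁ e)        = α-fpf z zB e
      outside (inj₂ (inj₁ e)) = contradictionᵇ (subst (λ t → E t ≡ true) e (EX.E-α z hz)) (F⇒∉E c hc)
      outside (inj₂ (inj₂ e)) = contradictionᵇ (subst (λ t → E t ≡ true) (injective pα z c zB cB e) hz) (F⇒∉E c hc)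

    ∉B₂⇒F : ∀ c → F c ≡ true → ∀ b → B M b ≡ true → B₂ b ≡ false → b ≡ c ⊎ b ≡ α M c
    ∉B₂⇒F c hc b hb h = EY.E-cases-from c hc b (EY.B∖E-complement b hb h)

    φ-orbit-αc↛z : ∀ {k} z c → E z ≡ true → F c ≡ true → σ M z ≡ c → σ M (α M c) ≡ α M c
                 → FirstHit φ B₂ k (α M c) z → ⊥
    φ-orbit-αc↛z z c hz hc σz≡c σαc≡αc (hit _ φαc≡z) =
      ¬[σz≡c×σc≡z×σαc≡αc] z c hz hc σz≡c (trans (cong (σ M) (sym (α-invol c (EY.E⊆B c hc)))) φαc≡z) σαc≡αc
    φ-orbit-αc↛z z c hz hc σz≡c σαc≡αc (skip h _)
      with ∉B₂⇒F c hc (σ M c) (σ-closed c (EY.E⊆B c hc)) (subst (λ t → B₂ (σ M t) ≡ false) (α-invol c (EY.E⊆B c hc)) h)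
    ... | inj₁ σc≡c  = contradictionᵇ (subst (λ t → E t ≡ true) (σ-inj z c (EX.E⊆B z hz) (EY.E⊆B c hc)
                                        (trans σz≡c (sym σc≡c))) hz) (F⇒∉E c hc)
    ... | inj₂ σc≡αc = α-fpf c (EY.E⊆B c hc)
            (sym (σ-inj c (α M c) (EY.E⊆B c hc) (α-closed c (EY.E⊆B c hc)) (trans σc≡αc (sym σαc≡αc))))

    φ-orbit-c↛z : ∀ {k} z c → E z ≡ true → F c ≡ true → σ M z ≡ c → FirstHit φ B₂ k c z → ⊥
    φ-orbit-c↛z z c hz hc σz≡c (hit _ φc≡z) = ¬[σz≡c×σαc≡z] z c hz hc σz≡c φc≡z
    φ-orbit-c↛z z c hz hc σz≡c (skip h p) with ∉B₂⇒F c hc (φ c) (σ-closed _ (α-closed c (EY.E⊆B c hc))) h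
    ... | inj₁ φc≡c  = firstHit-fixpoint φc≡c (∧-not-false hc) (skip h p)
    ... | inj₂ φc≡αc = φ-orbit-αc↛z z c hz hc σz≡c φc≡αc (subst (λ t → FirstHit φ B₂ _ t z) φc≡αc p)

    φ-orbit-αz↛z : ∀ {k} z → E z ≡ true → FirstHit φ B₂ k (α M z) z → ⊥
    φ-orbit-αz↛z z hz (hit _ φαz≡z) = σz≢z z hz (trans (cong (σ M) (sym (α-invol z (EX.E⊆B z hz)))) φαz≡z)
    φ-orbit-αz↛z z hz (skip h p) =
      φ-orbit-c↛z z (φ (α M z)) hz (EY.B∖E-complement _ (σ-closed _ (α-closed _ (α-closed z zB))) h)
        (cong (σ M) (sym (α-invol z zB))) p
      where
      zB : B M z ≡ true
      zB = EX.E⊆B z hz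

    σ₂z≢z : ∀ z → E z ≡ true → σ₂ z ≡ z → ⊥
    σ₂z≢z z hz σ₂z≡z = φ-orbit-αz↛z z hz
      (subst (FirstHit φ B₂ _ (α M z)) (trans (sym (cong (restrict φ B₂) (EY.restrict-α z hz₂))) σ₂z≡z)
        (proj₂ (restrict-firstHit pφ (α M z) (α-closed z (EX.E⊆B z hz)) (EY.B∖E-α z hz₂))))
      where
      hz₂ : B₂ z ≡ true
      hz₂ = E⊆B₂ z hz

    -- Q = N, and N = M₁ / f is the dual of M₁* ∖ f, which is connected.
    ConnQ : ∀ b c → C b ≡ true → C c ≡ true → Conn (B Q) (σ Q) (α Q) (λ _ → false) b c
    ConnQ b c hb hc =
      Conn-transport (proj₁ contract-delete≡delete-contract)
        (λ b h → proj₁ (proj₂ contract-delete≡delete-contract b h))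
        (λ b h → proj₂ (proj₂ contract-delete≡delete-contract b h)) (λ _ _ → refl)
        (Conn-dual DY₁.restrict-α-involution (DY₁.deletion-connected c₁ b c hb hc))

    ConnE₂ : Fin n → Fin n → Set
    ConnE₂ = DX₂.ConnK

    Conn-M₂ : ∀ b c → B₂ b ≡ true → B₂ c ≡ true → Conn B₂ σ₂ α₂ (λ _ → false) b c
    Conn-M₂ b c hb hc =
      Conn-dual EY.restrict-α-involution
        (DY.deletion-connected (dual-delete-connected⇒dual-connected c₁) b c hb hc)

    B₂⇒C⊎E : ∀ b → B₂ b ≡ true → C b ≡ true ⊎ E b ≡ true
    B₂⇒C⊎E b hb with C b in h
    ... | true  = inj₁ refl
    ... | false = inj₂ (∧-not-false⇒ hb (trans (cong (λ t → B₂ b ∧ not t) (sym (E₂≡E b))) (trans (B-Q≡C b) h)))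

    Hub : Fin n → Set
    Hub b = Σ (Fin n) λ w → C w ≡ true × ConnE₂ b w

    hub-σ₂ : ∀ b → B₂ b ≡ true → Hub (σ₂ b) → Hub b
    hub-σ₂ b hb (w , hw , p) = w , hw , σ-fwd hb p

    hub-or-swap : ∀ z → E z ≡ true → Hub z ⊎ σ₂ z ≡ α M z
    hub-or-swap z hz with B₂⇒C⊎E (σ₂ z) (closed pσ₂ z (E⊆B₂ z hz))
    ... | inj₁ h = inj₁ (σ₂ z , h , σ-fwd (E⊆B₂ z hz) done)
    ... | inj₂ h with EX.E-cases-from z hz (σ₂ z) h
    ... | inj₁ σ₂z≡z  = ⊥-elim (σ₂z≢z z hz σ₂z≡z)
    ... | inj₂ σ₂z≡αz = inj₂ σ₂z≡αz

    hubs⇒connected : Hub x → Hub (α M x) → ConnectedWithout M₂ x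
    hubs⇒connected hx hαx b c hb hc with hub b hb | hub c hc
      where
      hub : ∀ b → B₂ b ≡ true → Hub b
      hub b hb with B₂⇒C⊎E b hb
      ... | inj₁ h = b , h , done
      ... | inj₂ h with EX.E-cases b h
      ... | inj₁ refl = hx
      ... | inj₂ refl = hαx
    ... | wb , hwb , pb | wc , hwc , pc =
      Conn-trans pb (Conn-trans (DX₂.Conn∖⇒Conn (ConnQ wb wc hwb hwc)) (Conn-sym pc))

    -- If σ₂ swaps the two flags of e, then e is σ₂- and α₂-invariant, hence (M₂ being connected) all of B₂.
    swap⇒connected : σ₂ x ≡ α M x → σ₂ (α M x) ≡ x → ConnectedWithout M₂ x
    swap⇒connected σ₂x≡αx σ₂αx≡x b c hb hc = Conn-trans (to-x b (B₂⊆E b hb)) (Conn-sym (to-x c (B₂⊆E c hc)))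
      where
      hx : E x ≡ true
      hx = EX.E-self
      hσ₂x : E (σ₂ x) ≡ true
      hσ₂x = subst (λ t → E t ≡ true) (sym σ₂x≡αx) EX.E-partner
      hσ₂αx : E (σ₂ (α M x)) ≡ true
      hσ₂αx = subst (λ t → E t ≡ true) (sym σ₂αx≡x) hx
      B₂⊆E : ∀ b → B₂ b ≡ true → E b ≡ true
      B₂⊆E b hb = Conn-invariant (λ b → E b ≡ true)
        (λ b _ → EX.E-forward-closed σ₂ x hx hσ₂x hσ₂αx b)
        (EX.E-backward-closed pσ₂ E⊆B₂ x hx hσ₂x hσ₂αx)
        (λ b h _ hb → subst (λ t → E t ≡ true) (sym (EY.restrict-α b h)) (EX.E-α b hb))
        (λ b h _ hb → EX.E-α⁻ b (EY.B∖E⊆B b h) (subst (λ t → E t ≡ true) (EY.restrict-α b h) hb))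
        (Conn-M₂ x b (E⊆B₂ x hx) hb) hx
      to-x : ∀ b → E b ≡ true → ConnE₂ b x
      to-x b hb with EX.E-cases b hb
      ... | inj₁ refl = done
      ... | inj₂ refl = subst (λ t → ConnE₂ t x) σ₂x≡αx (σ-bwd (E⊆B₂ x hx) done)

    contract-connected : ConnectedWithout M₂ x
    contract-connected with hub-or-swap x EX.E-self | hub-or-swap (α M x) EX.E-partner
    ... | inj₁ hx | inj₁ hαx = hubs⇒connected hx hαx
    ... | inj₁ hx | inj₂ σ₂αx≡ααx =
      hubs⇒connected hx (hub-σ₂ (α M x) (E⊆B₂ _ EX.E-partner)
                          (subst Hub (sym (trans σ₂αx≡ααx (α-invol x xB))) hx))
    ... | inj₂ σ₂x≡αx | inj₁ hαx =
      hubs⇒connected (hub-σ₂ x (E⊆B₂ x EX.E-self) (subst Hub (sym σ₂x≡αx) hαx)) hαx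
    ... | inj₂ σ₂x≡αx | inj₂ σ₂αx≡ααx = swap⇒connected σ₂x≡αx (trans σ₂αx≡ααx (α-invol x xB))

lemma6 : ∀ {n} (M : RawMap n) → IsMap M → (x y : Fin n)
         → x ∈B M → y ∈B M
         → ¬ (y ≡ x) → ¬ (y ≡ α M x)
         → ¬ IsBridge M x
         → ¬ IsSepLoop (delete M x) y
         → ¬ IsSepLoop M y
           × ¬ IsBridge (contract M y) x
           × MapEq (contract (delete M x) y) (delete (contract M y) x)
lemma6 M isM x y xB yB y≢x y≢αx ¬bridge ¬sepLoop₁ =
    (λ sepLoop → ¬sepLoop₁ λ c₁ → sepLoop (dual-delete-connected⇒dual-connected c₁))
  , (λ bridge₂ → ¬sepLoop₁ λ c₁ → ¬bridge λ c₀ → bridge₂ (contract-connected c₀ c₁))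
  , contract-delete≡delete-contract
  where open TwoEdges M isM x y xB yB y≢x y≢αx
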